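{- Let $\mathscr{C}$ be a class closed under inverse length increasing morphisms and $A$ an alphabet. Let $\mathbf{P}$ and $\mathbf{Q}$ be finite partitions of $A^*$ such that $\mathbf{P}$ refines $\mathbf{Q}$. Then every language $L\subseteq A^*$ which is $\mathbf{Q}$-liftable from $\mathscr{C}$ is also $\mathbf{P}$-liftable from $\mathscr{C}$.
   Context: A class $\mathscr{C}$ assigns to each alphabet $A$ a set $\mathscr{C}(A)$ of regular languages over $A$; it is closed under inverse length increasing morphisms if $\alpha^{ -1}(L)\in\mathscr{C}(A)$ whenever $L\in\mathscr{C}(B)$ and $\alpha:A^*\to B^*$ is a monoid morphism with $\alpha(a)\neq\varepsilon$ for all $a\in A$. For a finite partition $\mathbf{P}$ of $A^*$, $[u]_{\mathbf{P}}$ denotes the block containing $u$, and $\tau_{\mathbf{P}}:A^*\to(\mathbf{P}\times A)^*$ maps $a_1\cdots a_n$ to $b_1\cdots b_n$ with $b_i=([a_1\cdots a_{i-1}]_{\mathbf{P}},a_i)$, $\tau_{\mathbf{P}}(\varepsilon)=\varepsilon$. A language $L\subseteq A^*$ is $\mathbf{P}$-liftable from $\mathscr{C}$ if there are $L_P\in\mathscr{C}(\mathbf{P}\times A)$ for each $P\in\mathbf{P}$ with $L=\bigcup_{P\in\mathbf{P}}(\tau_{\mathbf{P}}^{ -1}(L_P)\cap P)$. -}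

module Defs where

open import Data.Nat using (ℕ; _*_)
open import Data.Fin using (Fin)
open import Data.Fin.Properties using (*↔×)
open import Data.Bool using (Bool; true)
open import Data.List using (List; []; _∷_; _++_; [_]; concatMap)
open import Data.Product using (Σ; ∃; _×_; _,_)
open import Function using (_∘_; id)
open import Function.Bundles using (_↔_; _⇔_)
open import Function.Properties.Inverse using (↔-trans; ↔-refl)
open import Data.Product.Function.NonDependent.Propositional using (_×-↔_)
open import Relation.Binary.PropositionalEquality using (_≡_; _≢_)

record Alphabet : Set₁ where
  field
    Carrier : Set
    size    : ℕ
    enum    : Fin size ↔ Carrier
open Alphabet public

Lang : Alphabet → Set₁
Lang A = List (Carrier A) → Set

record DFA (A : Alphabet) : Set where
  field
    states : ℕ
    init   : Fin states
    δ      : Fin states → Carrier A → Fin states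
    final  : Fin states → Bool

run : ∀ {A} (M : DFA A) → Fin (DFA.states M) → List (Carrier A) → Fin (DFA.states M)
run M q []      = q
run M q (a ∷ w) = run M (DFA.δ M q a) w

Regular : (A : Alphabet) → Lang A → Set
Regular A L = Σ (DFA A) λ M → ∀ w → L w ⇔ (DFA.final M (run M (DFA.init M) w) ≡ true)

record Class : Set₂ where
  field
    mem     : (A : Alphabet) → Lang A → Set₁
    regular : ∀ A L → mem A L → Regular A L
open Class public

morph : ∀ {A B : Alphabet} → (Carrier A → List (Carrier B)) → List (Carrier A) → List (Carrier B)
morph α = concatMap α

LengthIncreasing : ∀ {A B : Alphabet} → (Carrier A → List (Carrier B)) → Set
LengthIncreasing α = ∀ a → α a ≢ []

preimage : ∀ {A B : Alphabet} → (Carrier A → List (Carrier B)) → Lang B → Lang A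
preimage {A} {B} α L = L ∘ morph {A} {B} α

ClosedUnderInvLIM : Class → Set₁
ClosedUnderInvLIM C =
  ∀ (A B : Alphabet) (α : Carrier A → List (Carrier B)) (L : Lang B) →
    LengthIncreasing {A} {B} α → mem C B L → mem C A (preimage {A} {B} α L)

record Partition (A : Alphabet) : Set where
  field
    nblocks  : ℕ
    blockOf  : List (Carrier A) → Fin nblocks
    nonempty : ∀ p → ∃ λ w → blockOf w ≡ p
open Partition public

InBlock : ∀ {A} (P : Partition A) → Fin (nblocks P) → Lang A
InBlock P p w = blockOf P w ≡ p

Refines : ∀ {A} → Partition A → Partition A → Set
Refines P Q = ∀ p → ∃ λ q → ∀ w → InBlock P p w → InBlock Q q w

_×A_ : ∀ {A} (P : Partition A) → (B : Alphabet) → Alphabet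
_×A_ P B = record
  { Carrier = Fin (nblocks P) × Carrier B
  ; size    = nblocks P * size B
  ; enum    = ↔-trans *↔× (↔-refl ×-↔ enum B)
  }

τ-from : ∀ {A} (P : Partition A) → List (Carrier A) → List (Carrier A) → List (Fin (nblocks P) × Carrier A)
τ-from P pre []      = []
τ-from P pre (a ∷ w) = (blockOf P pre , a) ∷ τ-from P (pre ++ [ a ]) w

τ : ∀ {A} (P : Partition A) → List (Carrier A) → List (Fin (nblocks P) × Carrier A)
τ P = τ-from P []

Liftable : (C : Class) → ∀ {A} (P : Partition A) → Lang A → Set₁
Liftable C {A} P L =
  Σ (Fin (nblocks P) → Lang (P ×A A)) λ Lp →
    (∀ p → mem C (P ×A A) (Lp p)) ×
    (∀ w → L w ⇔ (Σ (Fin (nblocks P)) λ p → Lp p (τ P w) × InBlock P p w))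

-- If every block of P lies in a block of Q, say blockOf Q = f ∘ blockOf P,
-- then τ_Q is τ_P followed by the letter-to-letter morphism (p , a) ↦ (f p , a).
-- So the Q-lift L_q of L pulls back along this length preserving morphism to a
-- P-lift, taking for the block p the pullback of L_(f p).
module Submission where

open import Defs
open import Data.Fin using (Fin)
open import Data.List using (List; []; _∷_; _++_; [_])
open import Data.Product using (Σ; _×_; _,_; proj₁; proj₂)
open import Function using (_∘′_)
open import Function.Bundles using (_⇔_; mk⇔; Equivalence)
open import Relation.Binary.PropositionalEquality
  using (_≡_; refl; sym; trans; cong; subst; subst₂)

module Coarsening {A : Alphabet} (P Q : Partition A)
  (f : Fin (nblocks P) → Fin (nblocks Q))
  (blockOf-f : ∀ w → blockOf Q w ≡ f (blockOf P w)) where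

  relabel : Carrier (P ×A A) → List (Carrier (Q ×A A))
  relabel (p , a) = [ (f p , a) ]

  relabel-lengthIncreasing : LengthIncreasing {P ×A A} {Q ×A A} relabel
  relabel-lengthIncreasing _ ()

  morph-relabel-τ-from : ∀ pre w →
    morph {P ×A A} {Q ×A A} relabel (τ-from P pre w) ≡ τ-from Q pre w
  morph-relabel-τ-from pre []      = refl
  morph-relabel-τ-from pre (a ∷ w)
    rewrite morph-relabel-τ-from (pre ++ [ a ]) w | blockOf-f pre = refl

  morph-relabel-τ : ∀ w → morph {P ×A A} {Q ×A A} relabel (τ P w) ≡ τ Q w
  morph-relabel-τ = morph-relabel-τ-from []

  liftable-coarsening : (C : Class) → ClosedUnderInvLIM C →
    (L : Lang A) → Liftable C Q L → Liftable C P L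
  liftable-coarsening C closed L (Lq , Lq∈C , L⇔) = Lp , Lp∈C , L⇔′
    where
    Lp : Fin (nblocks P) → Lang (P ×A A)
    Lp p = preimage {P ×A A} {Q ×A A} relabel (Lq (f p))

    Lp∈C : ∀ p → mem C (P ×A A) (Lp p)
    Lp∈C p = closed (P ×A A) (Q ×A A) relabel (Lq (f p))
      relabel-lengthIncreasing (Lq∈C (f p))

    lift : ∀ {w} → (Σ (Fin (nblocks Q)) λ q → Lq q (τ Q w) × InBlock Q q w) →
                   (Σ (Fin (nblocks P)) λ p → Lp p (τ P w) × InBlock P p w)
    lift {w} (q , lq , w∈q) =
      blockOf P w ,
      subst₂ Lq (trans (sym w∈q) (blockOf-f w)) (sym (morph-relabel-τ w)) lq ,
      refl

    unlift : ∀ {w} → (Σ (Fin (nblocks P)) λ p → Lp p (τ P w) × InBlock P p w) →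
                     (Σ (Fin (nblocks Q)) λ q → Lq q (τ Q w) × InBlock Q q w)
    unlift {w} (p , lp , w∈p) =
      f p ,
      subst (Lq (f p)) (morph-relabel-τ w) lp ,
      trans (blockOf-f w) (cong f w∈p)

    L⇔′ : ∀ w → L w ⇔ (Σ (Fin (nblocks P)) λ p → Lp p (τ P w) × InBlock P p w)
    L⇔′ w = mk⇔ (lift ∘′ Equivalence.to (L⇔ w)) (Equivalence.from (L⇔ w) ∘′ unlift)

lemma4p6 : (C : Class) → ClosedUnderInvLIM C → (A : Alphabet) →
    (P Q : Partition A) → Refines P Q →
    (L : Lang A) → Liftable C Q L → Liftable C P L
lemma4p6 C closed A P Q P⊑Q =
  Coarsening.liftable-coarsening P Q (λ p → proj₁ (P⊑Q p))
    (λ w → proj₂ (P⊑Q (blockOf P w)) w refl) C closed
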